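{- Let $\mathrm D$ be a delta-matroid on $[n,\bar n]$. Then, in $A^\bullet(X_{B_n})$, $c(\mathcal I_{\mathrm D})=c(\mathcal Q_{\mathrm D}^\vee)$ and $c(\mathcal I_{\mathrm D})\,c(\mathcal I_{\mathrm D}^\vee)=1$.
   Context: Notation: $[n,\bar n]=[n]\sqcup[\bar n]$ with involution $i\mapsto\bar i$; $\mathbf e_{\bar i}=-\mathbf e_i$. Admissible subsets contain no pair $\{i,\bar i\}$. A delta-matroid $\mathrm D$ is a nonempty collection $\mathcal F$ of maximal admissible subsets (feasible sets) such that every edge of $P(\mathrm D)=\operatorname{conv}\{\mathbf e_{B\cap[n]}:B\in\mathcal F\}$ is parallel to some $\mathbf e_i$ or $\mathbf e_i\pm\mathbf e_j$. $X_{B_n}$ is the smooth projective toric variety of the fan with maximal cones $\sigma_w=\mathbb R_{\ge0}\{\mathbf e_{w(1)},\dots,\mathbf e_{w(1)}+\dots+\mathbf e_{w(n)}\}$ for $w$ in the signed permutation group $W$ of $[n,\bar n]$; $K_T(X_{B_n})\subset\prod_{w\in W}\mathbb Z[T_1^{\pm1},\dots,T_n^{\pm1}]$ via localization at fixed points. $B_w(\mathrm D)$ is the feasible set whose vertex of $P(\mathrm D)$ minimizes the inner product with vectors in the interior of $\sigma_w$. With $T_{\bar i}=T_i^{ -1}$, $[\mathcal I_{\mathrm D}]_w=\sum_{i\in B_w(\mathrm D)}T_i$ and $[\mathcal Q_{\mathrm D}]=[\mathcal O^{\oplus2n+1}]-[\mathcal I_{\mathrm D}]$; these define classes in $K(X_{B_n})$.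 $c(-)$ denotes the total Chern class in $A^\bullet(X_{B_n})$, and $\vee$ the dual. -}

module Defs where

open import Data.Nat as ℕ using (ℕ; zero; suc)
open import Data.Integer as ℤ using (ℤ; +_; 0ℤ; 1ℤ)
open import Data.Bool using (Bool; true; false; if_then_else_; not)
open import Data.Fin as Fin using (Fin; toℕ; _≟_)
open import Data.Vec as V using (Vec; lookup; tabulate; _[_]≔_)
open import Data.Vec.Properties using (≡-dec)
open import Data.List as L using (List; []; _∷_; _++_; concatMap; allFin)
open import Data.Product using (Σ; Σ-syntax; ∃; _×_; _,_; proj₁; proj₂)
open import Data.Sum using (_⊎_)
open import Relation.Nullary using (does; ¬_)
open import Relation.Binary.PropositionalEquality using (_≡_; _≢_)

-- Polynomials in ℤ[t_0,…,t_{n-1}]: finite lists of (coefficient, exponent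
-- vector); two polynomials are equal iff all coefficients agree.

Mono : ℕ → Set
Mono n = Vec ℕ n

Poly : ℕ → Set
Poly n = List (ℤ × Mono n)

coeff : ∀ {n} → Poly n → Mono n → ℤ
coeff [] m = 0ℤ
coeff ((c , m′) ∷ p) m =
  if does (≡-dec ℕ._≟_ m′ m) then c ℤ.+ coeff p m else coeff p m

infix 4 _≈P_
_≈P_ : ∀ {n} → Poly n → Poly n → Set
p ≈P q = ∀ m → coeff p m ≡ coeff q m

infixl 6 _+P_ _-P_
infixl 7 _*P_

_+P_ : ∀ {n} → Poly n → Poly n → Poly n
_+P_ = _++_

-P_ : ∀ {n} → Poly n → Poly n
-P p = L.map (λ { (c , m) → (ℤ.- c , m) }) p

_-P_ : ∀ {n} → Poly n → Poly n → Poly n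
p -P q = p +P (-P q)

_*P_ : ∀ {n} → Poly n → Poly n → Poly n
p *P q = concatMap (λ { (c , m) → L.map (λ { (d , m′) → (c ℤ.* d , V.zipWith ℕ._+_ m m′) }) q }) p

constP : ∀ {n} → ℤ → Poly n
constP {n} c = (c , V.replicate n 0) ∷ []

unitMono : ∀ {n} → Fin n → Mono n
unitMono i = tabulate (λ j → if does (i ≟ j) then 1 else 0)

monoP : ∀ {n} → ℤ → Fin n → Poly n
monoP c i = (c , unitMono i) ∷ []

varP : ∀ {n} → Fin n → Poly n
varP = monoP 1ℤ

sumP : ∀ {n} → List (Poly n) → Poly n
sumP = L.foldr _+P_ []

prodP : ∀ {n} → List (Poly n) → Poly n
prodP = L.foldr _*P_ (constP 1ℤ)

Divides : ∀ {n} → Poly n → Poly n → Set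
Divides ℓ p = Σ[ q ∈ Poly _ ] (p ≈P ℓ *P q)

-- Elements of [n, n̄]: (i , true) is i, (i , false) is ī.
-- Signed permutations w ∈ W: the word (w(1),…,w(n)) as a vector of
-- signed elements whose underlying elements are pairwise distinct.

Signed : ℕ → Set
Signed n = Fin n × Bool

SVec : ℕ → Set
SVec n = Vec (Signed n) n

IsSignedPerm : ∀ {n} → SVec n → Set
IsSignedPerm w = ∀ i j → proj₁ (lookup w i) ≡ proj₁ (lookup w j) → i ≡ j

xt : ∀ {n} → Signed n → Poly n
xt (i , true)  = varP i
xt (i , false) = -P varP i

flipSign : ∀ {n} → Signed n → Signed n
flipSign (i , s) = (i , not s)

-- Piecewise polynomials on the fan of X_{B_n} (= A^•_T(X_{B_n})).
-- Maximal cones σ_w; walls of σ_w: removing the k-th ray (k < n) gives the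
-- neighbour w∘s_k (swap positions k,k+1), wall form x_{w(k)} - x_{w(k+1)};
-- removing the n-th ray gives the neighbour with last sign flipped,
-- wall form x_{w(n)}.

Piecewise : ℕ → Set
Piecewise n = SVec n → Poly n

swapAt : ∀ {n} → SVec n → Fin n → Fin n → SVec n
swapAt w i j = (w [ i ]≔ lookup w j) [ j ]≔ lookup w i

flipAt : ∀ {n} → SVec n → Fin n → SVec n
flipAt w i = w [ i ]≔ flipSign (lookup w i)

IsPiecewisePoly : ∀ {n} → Piecewise n → Set
IsPiecewisePoly {n} f = ∀ w → IsSignedPerm w →
    (∀ (i j : Fin n) → toℕ j ≡ suc (toℕ i) →
        Divides (xt (lookup w i) -P xt (lookup w j)) (f w -P f (swapAt w i j)))
  × (∀ (i : Fin n) → suc (toℕ i) ≡ n →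
        Divides (xt (lookup w i)) (f w -P f (flipAt w i)))

-- Equality in A^•(X_{B_n}) = A^•_T(X_{B_n}) / (t_1,…,t_n):
-- x - y = Σ_j t_j h_j with h_j piecewise polynomials.
infix 4 _~A_
_~A_ : ∀ {n} → Piecewise n → Piecewise n → Set
_~A_ {n} x y = Σ[ h ∈ (Fin n → Piecewise n) ]
    ((∀ j → IsPiecewisePoly (h j))
  × (∀ w → IsSignedPerm w →
       x w -P y w ≈P sumP (L.map (λ j → varP j *P h j w) (allFin n))))

-- T-equivariant K-classes given by localization: at each fixed point w
-- a virtual character  Σ_{pos} T^m − Σ_{neg} T^m,  m ∈ ℤ^n.

Char : ℕ → Set
Char n = Vec ℤ n

record VClass (n : ℕ) : Set where
  field
    pos : SVec n → List (Char n)
    neg : SVec n → List (Char n)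
open VClass public

c1 : ∀ {n} → Char n → Poly n
c1 {n} m = sumP (L.map (λ j → monoP (lookup m j) j) (allFin n))

cT : ∀ {n} → (SVec n → List (Char n)) → Piecewise n
cT L w = prodP (L.map (λ m → constP 1ℤ +P c1 m) (L w))

-- total Chern class of a virtual class as a fraction num/den (den a unit)
record ChernFrac (n : ℕ) : Set where
  constructor _//_
  field
    num : Piecewise n
    den : Piecewise n
open ChernFrac public

chern : ∀ {n} → VClass n → ChernFrac n
chern V = cT (pos V) // cT (neg V)

infixl 7 _·c_
_·c_ : ∀ {n} → ChernFrac n → ChernFrac n → ChernFrac n
(a // b) ·c (c // d) = (λ w → a w *P c w) // (λ w → b w *P d w)

oneC : ∀ {n} → ChernFrac n
oneC = (λ _ → constP 1ℤ) // (λ _ → constP 1ℤ)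

infix 4 _≋_
_≋_ : ∀ {n} → ChernFrac n → ChernFrac n → Set
(a // b) ≋ (c // d) = (λ w → a w *P d w) ~A (λ w → c w *P b w)

dualV : ∀ {n} → VClass n → VClass n
dualV V = record { pos = λ w → L.map (V.map (λ x → ℤ.- x)) (pos V w)
                 ; neg = λ w → L.map (V.map (λ x → ℤ.- x)) (neg V w) }

trivialV : ∀ {n} → ℕ → VClass n
trivialV {n} k = record { pos = λ _ → L.replicate k (V.replicate n 0ℤ) ; neg = λ _ → [] }

_⊖_ : ∀ {n} → VClass n → VClass n → VClass n
A ⊖ B = record { pos = λ w → pos A w ++ neg B w ; neg = λ w → neg A w ++ pos B w }

-- Delta-matroids.  A maximal admissible subset B of [n,n̄] is encoded by
-- b : Vec Bool n  (b_i = true iff i ∈ B, else ī ∈ B).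

Feas : ℕ → Set
Feas n = Vec Bool n

point : ∀ {n} → Feas n → Vec ℤ n
point = V.map (λ b → if b then 1ℤ else 0ℤ)

dot : ∀ {n} → Vec ℤ n → Vec ℤ n → ℤ
dot u v = V.foldr _ ℤ._+_ 0ℤ (V.zipWith ℤ._*_ u v)

-- [u,v] is an edge of conv{ point B : F B } : some linear functional is
-- minimised on the point set exactly at u and v (u ≠ v).
IsEdge : ∀ {n} → (Feas n → Bool) → Vec ℤ n → Vec ℤ n → Set
IsEdge {n} F u v = u ≢ v × Σ[ c ∈ Vec ℤ n ]
    ( (∀ C → F C ≡ true → dot c u ℤ.≤ dot c (point C))
    × dot c u ≡ dot c v
    × (∀ C → F C ≡ true → dot c (point C) ≡ dot c u → point C ≡ u ⊎ point C ≡ v))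

unitZ : ∀ {n} → Fin n → Vec ℤ n
unitZ i = tabulate (λ j → if does (i ≟ j) then 1ℤ else 0ℤ)

Parallel : ∀ {n} → Vec ℤ n → Vec ℤ n → Set
Parallel d g = Σ[ a ∈ ℤ ] Σ[ b ∈ ℤ ] (a ≢ 0ℤ × b ≢ 0ℤ ×
  (∀ k → a ℤ.* lookup d k ≡ b ℤ.* lookup g k))

ParallelToRoot : ∀ {n} → Vec ℤ n → Set
ParallelToRoot {n} d =
    (Σ[ i ∈ Fin n ] Parallel d (unitZ i))
  ⊎ (Σ[ i ∈ Fin n ] Σ[ j ∈ Fin n ] (Parallel d (V.zipWith ℤ._+_ (unitZ i) (unitZ j))
                                   ⊎ Parallel d (V.zipWith ℤ._-_ (unitZ i) (unitZ j))))

record DeltaMatroid (n : ℕ) : Set where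
  field
    feasible : Feas n → Bool
    nonempty : ∃ λ B → feasible B ≡ true
    edges    : ∀ B B′ → feasible B ≡ true → feasible B′ ≡ true →
               IsEdge feasible (point B) (point B′) →
               ParallelToRoot (V.zipWith ℤ._-_ (point B′) (point B))
open DeltaMatroid public

-- B_w(D).  Rays of σ_w: g_k = e_{w(1)} + … + e_{w(k)}, e_{ī} = -e_i.
-- Interior (rational) points, up to positive scaling: Σ_k (a_k + 1) g_k.

sunitZ : ∀ {n} → Signed n → Vec ℤ n
sunitZ (i , true)  = unitZ i
sunitZ (i , false) = V.map (λ x → ℤ.- x) (unitZ i)

vsum : ∀ {n} → List (Vec ℤ n) → Vec ℤ n
vsum {n} = L.foldr (V.zipWith ℤ._+_) (V.replicate n 0ℤ)

ray : ∀ {n} → SVec n → Fin n → Vec ℤ n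
ray {n} w k = vsum (L.map (λ j → if toℕ j ℕ.≤ᵇ toℕ k then sunitZ (lookup w j) else V.replicate n 0ℤ) (allFin n))

interiorPt : ∀ {n} → SVec n → Vec ℕ n → Vec ℤ n
interiorPt {n} w a = vsum (L.map (λ k → V.map (λ x → + suc (lookup a k) ℤ.* x) (ray w k)) (allFin n))

IsBw : ∀ {n} → DeltaMatroid n → (SVec n → Feas n) → Set
IsBw {n} D bw = ∀ w → IsSignedPerm w →
    feasible D (bw w) ≡ true
  × (∀ (a : Vec ℕ n) C → feasible D C ≡ true →
       dot (interiorPt w a) (point (bw w)) ℤ.≤ dot (interiorPt w a) (point C))

I-D : ∀ {n} → (SVec n → Feas n) → VClass n
I-D {n} bw = record
  { pos = λ w → L.map (λ i → sunitZ (i , lookup (bw w) i)) (allFin n)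
  ; neg = λ _ → [] }

Q-D : ∀ {n} → (SVec n → Feas n) → VClass n
Q-D {n} bw = trivialV (suc (2 ℕ.* n)) ⊖ I-D bw

{-# OPTIONS --safe #-}
-- At a fixed point w, I_D restricts to the n characters T_i^{±1}, the signs being read off
-- B_w(D). Hence c^T(I_D)_w · c^T(I_D^∨)_w = Π_i (1 ± t_i)(1 ∓ t_i) = Π_i (1 - t_i²), a polynomial
-- that depends neither on w nor on D.
-- This constant polynomial minus 1 is Σ_j t_j h_j with constant, hence piecewise polynomial,
-- cofactors h_j, so the product is 1 in A^•(X_{B_n}) = A^•_T(X_{B_n}) / (t_1, …, t_n).
-- Since [Q_D^∨] = [O^{2n+1}] - [I_D^∨], c(Q_D^∨) = c(I_D^∨)^{-1}, and the first identity is the second.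
module Submission where

open import Defs
open import Level using (0ℓ; _⊔_)
open import Algebra.Bundles using (AbelianGroup; CommutativeRing)
open import Algebra.Structures using (IsAbelianGroup)
import Algebra.Properties.CommutativeSemigroup as CommutativeSemigroupProperties
open import Data.Nat as ℕ using (ℕ; zero; suc)
import Data.Nat.Properties as ℕP
open import Data.Integer as ℤ using (ℤ; 0ℤ; 1ℤ)
import Data.Integer.Properties as ℤP
open import Data.Bool using (true; false)
open import Data.Fin using (Fin)
import Data.Vec as V
open import Data.Vec.Properties
  using (≡-dec; lookup-map; lookup-replicate; zipWith-comm; zipWith-assoc; zipWith-identityˡ; zipWith-identityʳ)
open import Data.List as L using (List; []; _∷_; _++_; allFin)
import Data.List.Properties as LP
open import Data.Product using (Σ-syntax; ∃; _×_; _,_)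
open import Relation.Nullary using (Dec; yes; no; does; ¬_)
open import Data.Empty using (⊥-elim)
open import Relation.Binary.Bundles using (Setoid)
open import Relation.Binary.Structures using (IsEquivalence)
open import Relation.Binary.PropositionalEquality as ≡ using (_≡_)

-- Sums, products and finitely generated ideals in a commutative ring

module ListAlgebra {c ℓ} (R : CommutativeRing c ℓ) where
  open CommutativeRing R
  open import Algebra.Properties.Ring ring using (-‿distribˡ-*; -‿distribʳ-*; -‿involutive)
  open CommutativeSemigroupProperties +-commutativeSemigroup using () renaming (interchange to +-interchange)
  open CommutativeSemigroupProperties *-commutativeSemigroup using () renaming (interchange to *-interchange)
  open import Relation.Binary.Reasoning.Setoid setoid

  ∑ : List Carrier → Carrier
  ∑ = L.foldr _+_ 0#

  ∏ : List Carrier → Carrier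
  ∏ = L.foldr _*_ 1#

  module _ {a} {A : Set a} where

    ∑-map-cong : ∀ xs {f g : A → Carrier} → (∀ x → f x ≈ g x) → ∑ (L.map f xs) ≈ ∑ (L.map g xs)
    ∑-map-cong []       f≈g = refl
    ∑-map-cong (x ∷ xs) f≈g = +-cong (f≈g x) (∑-map-cong xs f≈g)

    ∑-map-0# : ∀ (xs : List A) → ∑ (L.map (λ _ → 0#) xs) ≈ 0#
    ∑-map-0# []       = refl
    ∑-map-0# (x ∷ xs) = trans (+-identityˡ _) (∑-map-0# xs)

    ∑-map-distrib-+ : ∀ xs (f g : A → Carrier) →
                      ∑ (L.map (λ x → f x + g x) xs) ≈ ∑ (L.map f xs) + ∑ (L.map g xs)
    ∑-map-distrib-+ []       f g = sym (+-identityˡ 0#)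
    ∑-map-distrib-+ (x ∷ xs) f g =
      trans (+-congˡ (∑-map-distrib-+ xs f g)) (+-interchange (f x) (g x) _ _)

    ∑-map-*ʳ : ∀ xs (f : A → Carrier) y → ∑ (L.map f xs) * y ≈ ∑ (L.map (λ x → f x * y) xs)
    ∑-map-*ʳ []       f y = zeroˡ y
    ∑-map-*ʳ (x ∷ xs) f y = trans (distribʳ y (f x) _) (+-congˡ (∑-map-*ʳ xs f y))

    ∏-map-cong : ∀ xs {f g : A → Carrier} → (∀ x → f x ≈ g x) → ∏ (L.map f xs) ≈ ∏ (L.map g xs)
    ∏-map-cong []       f≈g = refl
    ∏-map-cong (x ∷ xs) f≈g = *-cong (f≈g x) (∏-map-cong xs f≈g)

    ∏-map-distrib-* : ∀ xs (f g : A → Carrier) →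
                      ∏ (L.map f xs) * ∏ (L.map g xs) ≈ ∏ (L.map (λ x → f x * g x) xs)
    ∏-map-distrib-* []       f g = *-identityˡ 1#
    ∏-map-distrib-* (x ∷ xs) f g =
      trans (*-interchange (f x) _ (g x) _) (*-congˡ (∏-map-distrib-* xs f g))

  [1+x][1-x]≈1-x² : ∀ x → (1# + x) * (1# - x) ≈ 1# - x * x
  [1+x][1-x]≈1-x² x = begin
    (1# + x) * (1# - x)               ≈⟨ distribʳ (1# - x) 1# x ⟩
    1# * (1# - x) + x * (1# - x)      ≈⟨ +-cong (*-identityˡ _) (distribˡ x 1# (- x)) ⟩
    (1# - x) + (x * 1# + x * - x)     ≈⟨ +-congˡ (+-cong (*-identityʳ x) (sym (-‿distribʳ-* x x))) ⟩
    (1# - x) + (x - x * x)            ≈⟨ +-assoc 1# (- x) _ ⟩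
    1# + (- x + (x - x * x))          ≈⟨ +-congˡ (sym (+-assoc (- x) x _)) ⟩
    1# + ((- x + x) - x * x)          ≈⟨ +-congˡ (+-congʳ (-‿inverseˡ x)) ⟩
    1# + (0# - x * x)                 ≈⟨ +-congˡ (+-identityˡ _) ⟩
    1# - x * x                        ∎

  -x*-x≈x*x : ∀ x → - x * - x ≈ x * x
  -x*-x≈x*x x = begin
    - x * - x     ≈⟨ -‿distribˡ-* x (- x) ⟨
    - (x * - x)   ≈⟨ -‿cong (-‿distribʳ-* x x) ⟨
    - - (x * x)   ≈⟨ -‿involutive (x * x) ⟩
    x * x         ∎

  module Ideal {a} {A : Set a} (t : A → Carrier) (js : List A) where

    InIdeal : Carrier → Set (a ⊔ c ⊔ ℓ)
    InIdeal x = Σ[ h ∈ (A → Carrier) ] x ≈ ∑ (L.map (λ j → t j * h j) js)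

    InIdeal-resp-≈ : ∀ {x y} → x ≈ y → InIdeal x → InIdeal y
    InIdeal-resp-≈ x≈y (h , x≈) = h , trans (sym x≈y) x≈

    0#-InIdeal : InIdeal 0#
    0#-InIdeal = (λ _ → 0#) , sym (trans (∑-map-cong js (λ j → zeroʳ (t j))) (∑-map-0# js))

    +-InIdeal : ∀ {x y} → InIdeal x → InIdeal y → InIdeal (x + y)
    +-InIdeal (h , x≈) (g , y≈) = (λ j → h j + g j) , (begin
      _ + _                                          ≈⟨ +-cong x≈ y≈ ⟩
      ∑ (L.map (λ j → t j * h j) js) + ∑ (L.map (λ j → t j * g j) js)
                                                     ≈⟨ ∑-map-distrib-+ js _ _ ⟨
      ∑ (L.map (λ j → t j * h j + t j * g j) js)     ≈⟨ ∑-map-cong js (λ j → distribˡ (t j) (h j) (g j)) ⟨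
      ∑ (L.map (λ j → t j * (h j + g j)) js)         ∎)

    *ʳ-InIdeal : ∀ {x} y → InIdeal x → InIdeal (x * y)
    *ʳ-InIdeal y (h , x≈) = (λ j → h j * y) , (begin
      _ * y                                          ≈⟨ *-congʳ x≈ ⟩
      ∑ (L.map (λ j → t j * h j) js) * y             ≈⟨ ∑-map-*ʳ js _ y ⟩
      ∑ (L.map (λ j → t j * h j * y) js)             ≈⟨ ∑-map-cong js (λ j → *-assoc (t j) (h j) y) ⟩
      ∑ (L.map (λ j → t j * (h j * y)) js)           ∎)

    ∏[1+x]-1-InIdeal : ∀ {b} {B : Set b} (is : List B) (x : B → Carrier) →
                       (∀ i → InIdeal (x i)) → InIdeal (∏ (L.map (λ i → 1# + x i) is) - 1#)
    ∏[1+x]-1-InIdeal []       x x∈ = InIdeal-resp-≈ (sym (-‿inverseʳ 1#)) 0#-InIdeal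
    ∏[1+x]-1-InIdeal (i ∷ is) x x∈ =
      InIdeal-resp-≈ step (+-InIdeal (∏[1+x]-1-InIdeal is x x∈) (*ʳ-InIdeal P (x∈ i)))
      where
      P = ∏ (L.map (λ i → 1# + x i) is)
      step : (P - 1#) + x i * P ≈ (1# + x i) * P - 1#
      step = begin
        (P - 1#) + x i * P          ≈⟨ +-assoc P (- 1#) _ ⟩
        P + (- 1# + x i * P)        ≈⟨ +-congˡ (+-comm (- 1#) _) ⟩
        P + (x i * P - 1#)          ≈⟨ +-assoc P _ (- 1#) ⟨
        (P + x i * P) - 1#          ≈⟨ +-congʳ (+-congʳ (*-identityˡ P)) ⟨
        (1# * P + x i * P) - 1#     ≈⟨ +-congʳ (distribʳ P 1# (x i)) ⟨
        (1# + x i) * P - 1#         ∎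

open ≡ using (refl; sym; trans; cong; cong₂; subst)

-- The polynomial ring ℤ[t_1, …, t_n]

infixl 6 _+ₘ_
_+ₘ_ : ∀ {n} → Mono n → Mono n → Mono n
_+ₘ_ = V.zipWith ℕ._+_

_∸ₘ_ : ∀ {n} → Mono n → Mono n → Mono n
_∸ₘ_ = V.zipWith ℕ._∸_

m+ₘn∸ₘm≡n : ∀ {n} (a b : Mono n) → (a +ₘ b) ∸ₘ a ≡ b
m+ₘn∸ₘm≡n V.[]       V.[]       = refl
m+ₘn∸ₘm≡n (x V.∷ a) (y V.∷ b) = cong₂ V._∷_ (ℕP.m+n∸m≡n x y) (m+ₘn∸ₘm≡n a b)

+ₘ-cancelˡ : ∀ {n} (a : Mono n) {b c} → a +ₘ b ≡ a +ₘ c → b ≡ c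
+ₘ-cancelˡ a {b} {c} eq =
  trans (sym (m+ₘn∸ₘm≡n a b)) (trans (cong (_∸ₘ a) eq) (m+ₘn∸ₘm≡n a c))

infix 4 _∣ₘ_ _∣ₘ?_
_∣ₘ_ : ∀ {n} → Mono n → Mono n → Set
a ∣ₘ m = ∃ λ k → a +ₘ k ≡ m

_∣ₘ?_ : ∀ {n} (a m : Mono n) → Dec (a ∣ₘ m)
a ∣ₘ? m with ≡-dec ℕ._≟_ (a +ₘ (m ∸ₘ a)) m
... | yes a+[m∸a]≡m = yes (m ∸ₘ a , a+[m∸a]≡m)
... | no  a+[m∸a]≢m = no λ { (k , a+k≡m) →
  a+[m∸a]≢m (subst (λ m → a +ₘ (m ∸ₘ a) ≡ m) a+k≡m (cong (a +ₘ_) (m+ₘn∸ₘm≡n a k))) }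

Term : ℕ → Set
Term n = ℤ × Mono n

_·ₜ_ : ∀ {n} → Term n → Term n → Term n
(c , a) ·ₜ (d , b) = (c ℤ.* d , a +ₘ b)

scale : ∀ {n} → Term n → Poly n → Poly n
scale t = L.map (t ·ₜ_)

module _ {n : ℕ} where

  coeff-++ : ∀ (p q : Poly n) m → coeff (p ++ q) m ≡ coeff p m ℤ.+ coeff q m
  coeff-++ []             q m = sym (ℤP.+-identityˡ _)
  coeff-++ ((c , a) ∷ p) q m with does (≡-dec ℕ._≟_ a m)
  ... | true  = trans (cong (λ z → c ℤ.+ z) (coeff-++ p q m)) (sym (ℤP.+-assoc c _ _))
  ... | false = coeff-++ p q m

  coeff-neg : ∀ (p : Poly n) m → coeff (-P p) m ≡ ℤ.- coeff p m
  coeff-neg []             m = refl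
  coeff-neg ((c , a) ∷ p) m with does (≡-dec ℕ._≟_ a m)
  ... | true  = trans (cong (λ z → ℤ.- c ℤ.+ z) (coeff-neg p m)) (sym (ℤP.neg-distrib-+ c _))
  ... | false = coeff-neg p m

  coeff-scale : ∀ c {a k m} (q : Poly n) → a +ₘ k ≡ m → coeff (scale (c , a) q) m ≡ c ℤ.* coeff q k
  coeff-scale c         []             a+k≡m = sym (ℤP.*-zeroʳ c)
  coeff-scale c {a} {k} {m} ((d , b) ∷ q) a+k≡m
    with ≡-dec ℕ._≟_ (a +ₘ b) m | ≡-dec ℕ._≟_ b k
  ... | yes _     | yes _   = trans (cong (λ z → c ℤ.* d ℤ.+ z) (coeff-scale c q a+k≡m)) (sym (ℤP.*-distribˡ-+ c d _))
  ... | yes a+b≡m | no  b≢k = ⊥-elim (b≢k (+ₘ-cancelˡ a (trans a+b≡m (sym a+k≡m))))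
  ... | no  a+b≢m | yes b≡k = ⊥-elim (a+b≢m (trans (cong (a +ₘ_) b≡k) a+k≡m))
  ... | no  _     | no  _   = coeff-scale c q a+k≡m

  coeff-scale-∤ : ∀ c {a m} (q : Poly n) → ¬ a ∣ₘ m → coeff (scale (c , a) q) m ≡ 0ℤ
  coeff-scale-∤ c         []             a∤m = refl
  coeff-scale-∤ c {a} {m} ((d , b) ∷ q) a∤m with ≡-dec ℕ._≟_ (a +ₘ b) m
  ... | yes a+b≡m = ⊥-elim (a∤m (b , a+b≡m))
  ... | no  _     = coeff-scale-∤ c q a∤m

-- A record around _≈P_, so that both polynomials can be inferred from a proof.
infix 4 _≃_
record _≃_ {n} (p q : Poly n) : Set where
  constructor mk≃
  field coeff-≡ : p ≈P q
open _≃_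

module _ {n : ℕ} where

  ≃-isEquivalence : IsEquivalence (_≃_ {n})
  ≃-isEquivalence = record
    { refl  = mk≃ λ _ → refl
    ; sym   = λ p≃q → mk≃ λ m → sym (coeff-≡ p≃q m)
    ; trans = λ p≃q q≃r → mk≃ λ m → trans (coeff-≡ p≃q m) (coeff-≡ q≃r m)
    }

  ≃-setoid : Setoid 0ℓ 0ℓ
  ≃-setoid = record { isEquivalence = ≃-isEquivalence }

  open IsEquivalence ≃-isEquivalence public using () renaming (refl to ≃-refl; sym to ≃-sym; trans to ≃-trans)

  ≡⇒≃ : ∀ {p q : Poly n} → p ≡ q → p ≃ q
  ≡⇒≃ refl = ≃-refl

  monoP-0ℤ : ∀ (j : Fin n) → monoP 0ℤ j ≃ []
  monoP-0ℤ j = mk≃ coeff-0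
    where
    coeff-0 : ∀ m → coeff (monoP 0ℤ j) m ≡ 0ℤ
    coeff-0 m with does (≡-dec ℕ._≟_ (unitMono j) m)
    ... | true  = refl
    ... | false = refl

  +-cong : ∀ {p p′ q q′ : Poly n} → p ≃ p′ → q ≃ q′ → p +P q ≃ p′ +P q′
  +-cong {p} {p′} {q} {q′} p≃p′ q≃q′ = mk≃ λ m → begin
    coeff (p ++ q) m               ≡⟨ coeff-++ p q m ⟩
    coeff p m ℤ.+ coeff q m        ≡⟨ cong₂ ℤ._+_ (coeff-≡ p≃p′ m) (coeff-≡ q≃q′ m) ⟩
    coeff p′ m ℤ.+ coeff q′ m      ≡⟨ coeff-++ p′ q′ m ⟨
    coeff (p′ ++ q′) m             ∎
    where open ≡.≡-Reasoning

  +-comm : ∀ (p q : Poly n) → p +P q ≃ q +P p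
  +-comm p q = mk≃ λ m → begin
    coeff (p ++ q) m               ≡⟨ coeff-++ p q m ⟩
    coeff p m ℤ.+ coeff q m        ≡⟨ ℤP.+-comm (coeff p m) (coeff q m) ⟩
    coeff q m ℤ.+ coeff p m        ≡⟨ coeff-++ q p m ⟨
    coeff (q ++ p) m               ∎
    where open ≡.≡-Reasoning

  -‿cong : ∀ {p q : Poly n} → p ≃ q → -P p ≃ -P q
  -‿cong {p} {q} p≃q = mk≃ λ m →
    trans (coeff-neg p m) (trans (cong ℤ.-_ (coeff-≡ p≃q m)) (sym (coeff-neg q m)))

  -‿inverseˡ : ∀ (p : Poly n) → -P p +P p ≃ []
  -‿inverseˡ p = mk≃ λ m → begin
    coeff (-P p ++ p) m                 ≡⟨ coeff-++ (-P p) p m ⟩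
    coeff (-P p) m ℤ.+ coeff p m        ≡⟨ cong (ℤ._+ coeff p m) (coeff-neg p m) ⟩
    ℤ.- coeff p m ℤ.+ coeff p m         ≡⟨ ℤP.+-inverseˡ (coeff p m) ⟩
    0ℤ                                  ∎
    where open ≡.≡-Reasoning

  +-isAbelianGroup : IsAbelianGroup (_≃_ {n}) _+P_ [] (λ p → -P p)
  +-isAbelianGroup = record
    { isGroup = record
      { isMonoid = record
        { isSemigroup = record
          { isMagma = record { isEquivalence = ≃-isEquivalence ; ∙-cong = +-cong }
          ; assoc   = λ p q r → ≡⇒≃ (LP.++-assoc p q r)
          }
        ; identity = (λ _ → ≃-refl) , (λ p → ≡⇒≃ (LP.++-identityʳ p))
        }
      ; inverse = -‿inverseˡ , (λ p → ≃-trans (+-comm p (-P p)) (-‿inverseˡ p))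
      ; ⁻¹-cong = -‿cong
      }
    ; comm = +-comm
    }

  +-abelianGroup : AbelianGroup 0ℓ 0ℓ
  +-abelianGroup = record { isAbelianGroup = +-isAbelianGroup }

  open CommutativeSemigroupProperties (AbelianGroup.commutativeSemigroup +-abelianGroup)
    using () renaming (interchange to +-interchange)

  ·ₜ-comm : ∀ (s t : Term n) → s ·ₜ t ≡ t ·ₜ s
  ·ₜ-comm (c , a) (d , b) = cong₂ _,_ (ℤP.*-comm c d) (zipWith-comm ℕP.+-comm a b)

  ·ₜ-assoc : ∀ (s t u : Term n) → (s ·ₜ t) ·ₜ u ≡ s ·ₜ (t ·ₜ u)
  ·ₜ-assoc (c , a) (d , b) (e , m) = cong₂ _,_ (ℤP.*-assoc c d e) (zipWith-assoc ℕP.+-assoc a b m)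

  ·ₜ-identityˡ : ∀ (t : Term n) → (1ℤ , V.replicate n 0) ·ₜ t ≡ t
  ·ₜ-identityˡ (d , b) = cong₂ _,_ (ℤP.*-identityˡ d) (zipWith-identityˡ ℕP.+-identityˡ b)

  scale-cong : ∀ t {q q′ : Poly n} → q ≃ q′ → scale t q ≃ scale t q′
  scale-cong (c , a) {q} {q′} q≃q′ = mk≃ coeff-scale-≡
    where
    coeff-scale-≡ : ∀ m → coeff (scale (c , a) q) m ≡ coeff (scale (c , a) q′) m
    coeff-scale-≡ m with a ∣ₘ? m
    ... | yes (k , a+k≡m) = trans (coeff-scale c q a+k≡m)
                              (trans (cong (c ℤ.*_) (coeff-≡ q≃q′ k)) (sym (coeff-scale c q′ a+k≡m)))
    ... | no  a∤m         = trans (coeff-scale-∤ c q a∤m) (sym (coeff-scale-∤ c q′ a∤m))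

  scale-identity : ∀ (p : Poly n) → scale (1ℤ , V.replicate n 0) p ≡ p
  scale-identity p = trans (LP.map-cong ·ₜ-identityˡ p) (LP.map-id p)

  scale-scale : ∀ s t (r : Poly n) → scale (s ·ₜ t) r ≡ scale s (scale t r)
  scale-scale s t r = trans (LP.map-cong (·ₜ-assoc s t) r) (LP.map-∘ r)

  scale-*P : ∀ t (q r : Poly n) → scale t q *P r ≡ scale t (q *P r)
  scale-*P t []      r = refl
  scale-*P t (s ∷ q) r = begin
    scale (t ·ₜ s) r ++ scale t q *P r       ≡⟨ cong₂ _++_ (scale-scale t s r) (scale-*P t q r) ⟩
    scale t (scale s r) ++ scale t (q *P r)  ≡⟨ LP.map-++ (t ·ₜ_) (scale s r) (q *P r) ⟨
    scale t (scale s r ++ q *P r)            ∎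
    where open ≡.≡-Reasoning

  *-singletonʳ : ∀ (q : Poly n) t → q *P (t ∷ []) ≡ scale t q
  *-singletonʳ []      t = refl
  *-singletonʳ (s ∷ q) t = cong₂ _∷_ (·ₜ-comm s t) (*-singletonʳ q t)

  *-zeroʳ : ∀ (p : Poly n) → p *P [] ≡ []
  *-zeroʳ []      = refl
  *-zeroʳ (t ∷ p) = *-zeroʳ p

  *-congˡ : ∀ (p : Poly n) {q q′} → q ≃ q′ → p *P q ≃ p *P q′
  *-congˡ []      q≃q′ = ≃-refl
  *-congˡ (t ∷ p) q≃q′ = +-cong (scale-cong t q≃q′) (*-congˡ p q≃q′)

  *-distribʳ : ∀ (p q r : Poly n) → (p +P q) *P r ≡ p *P r +P q *P r
  *-distribʳ p q r = LP.concatMap-++ _ p q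

  *-distribˡ : ∀ (p q r : Poly n) → p *P (q +P r) ≃ p *P q +P p *P r
  *-distribˡ []      q r = ≃-refl
  *-distribˡ (t ∷ p) q r = begin
    scale t (q ++ r) ++ p *P (q ++ r)               ≡⟨ cong (_++ p *P (q ++ r)) (LP.map-++ (t ·ₜ_) q r) ⟩
    (scale t q ++ scale t r) ++ p *P (q ++ r)       ≈⟨ +-cong ≃-refl (*-distribˡ p q r) ⟩
    (scale t q ++ scale t r) ++ (p *P q ++ p *P r)  ≈⟨ +-interchange (scale t q) (scale t r) _ _ ⟩
    (scale t q ++ p *P q) ++ (scale t r ++ p *P r)  ∎
    where open import Relation.Binary.Reasoning.Setoid ≃-setoid

  *-comm : ∀ (p q : Poly n) → p *P q ≃ q *P p
  *-comm []      q = ≡⇒≃ (sym (*-zeroʳ q))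
  *-comm (t ∷ p) q = begin
    scale t q ++ p *P q         ≈⟨ +-cong (≡⇒≃ (sym (*-singletonʳ q t))) (*-comm p q) ⟩
    q *P (t ∷ []) ++ q *P p     ≈⟨ *-distribˡ q (t ∷ []) p ⟨
    q *P (t ∷ p)                ∎
    where open import Relation.Binary.Reasoning.Setoid ≃-setoid

  *-assoc : ∀ (p q r : Poly n) → (p *P q) *P r ≃ p *P (q *P r)
  *-assoc []      q r = ≃-refl
  *-assoc (t ∷ p) q r = begin
    (scale t q ++ p *P q) *P r          ≡⟨ *-distribʳ (scale t q) (p *P q) r ⟩
    scale t q *P r ++ (p *P q) *P r     ≈⟨ +-cong (≡⇒≃ (scale-*P t q r)) (*-assoc p q r) ⟩
    scale t (q *P r) ++ p *P (q *P r)   ∎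
    where open import Relation.Binary.Reasoning.Setoid ≃-setoid

  *-identityˡ : ∀ (p : Poly n) → constP 1ℤ *P p ≃ p
  *-identityˡ p = ≡⇒≃ (trans (LP.++-identityʳ _) (scale-identity p))

  *-identityʳ : ∀ (p : Poly n) → p *P constP 1ℤ ≃ p
  *-identityʳ p = ≃-trans (*-comm p (constP 1ℤ)) (*-identityˡ p)

  *-cong : ∀ {p p′ q q′ : Poly n} → p ≃ p′ → q ≃ q′ → p *P q ≃ p′ *P q′
  *-cong {p} {p′} {q} {q′} p≃p′ q≃q′ =
    ≃-trans (*-congˡ p q≃q′) (≃-trans (*-comm p q′) (≃-trans (*-congˡ q′ p≃p′) (*-comm q′ p′)))

Poly-commutativeRing : ℕ → CommutativeRing 0ℓ 0ℓ
Poly-commutativeRing n = record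
  { Carrier = Poly n ; _≈_ = _≃_ ; _+_ = _+P_ ; _*_ = _*P_ ; -_ = λ p → -P p ; 0# = [] ; 1# = constP 1ℤ
  ; isCommutativeRing = record
    { isRing = record
      { +-isAbelianGroup = +-isAbelianGroup
      ; *-cong           = *-cong
      ; *-assoc          = *-assoc
      ; *-identity       = *-identityˡ , *-identityʳ
      ; distrib          = *-distribˡ , λ p q r → ≡⇒≃ (*-distribʳ q r p)
      }
    ; *-comm = *-comm
    }
  }

-- Equivariant total Chern classes at the fixed points

negᵥ : ∀ {n} → Char n → Char n
negᵥ = V.map (λ x → ℤ.- x)

module ChernClasses (n : ℕ) where
  open ListAlgebra (Poly-commutativeRing n)
  open Ideal varP (allFin n)
  open import Algebra.Properties.Ring (CommutativeRing.ring (Poly-commutativeRing n)) using (-‿distribʳ-*)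

  cChar : Char n → Poly n
  cChar m = constP 1ℤ +P c1 m

  t : Fin n → Poly n
  t i = c1 (unitZ i)

  ∏[1-t²] : Poly n
  ∏[1-t²] = ∏ (L.map (λ i → constP 1ℤ -P t i *P t i) (allFin n))

  monoP≡varP*constP : ∀ c (j : Fin n) → monoP c j ≡ varP j *P constP c
  monoP≡varP*constP c j =
    cong (_∷ []) (sym (cong₂ _,_ (ℤP.*-identityˡ c) (zipWith-identityʳ ℕP.+-identityʳ (unitMono j))))

  c1-InIdeal : ∀ m → InIdeal (c1 m)
  c1-InIdeal m = (λ j → constP (V.lookup m j)) ,
    ≡⇒≃ (cong ∑ (LP.map-cong (λ j → monoP≡varP*constP (V.lookup m j) j) (allFin n)))

  c1-negᵥ : ∀ m → c1 (negᵥ m) ≡ -P c1 m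
  c1-negᵥ m = begin
    ∑ (L.map (λ j → monoP (V.lookup (negᵥ m) j) j) (allFin n))
      ≡⟨ cong ∑ (LP.map-cong (λ j → cong (λ c → monoP c j) (lookup-map j (λ x → ℤ.- x) m)) (allFin n)) ⟩
    ∑ (L.map (λ j → -P monoP (V.lookup m j) j) (allFin n))
      ≡⟨ cong ∑ (LP.map-∘ (allFin n)) ⟩
    ∑ (L.map (λ p → -P p) (L.map (λ j → monoP (V.lookup m j) j) (allFin n)))
      ≡⟨ LP.concat-map (L.map (λ j → monoP (V.lookup m j) j) (allFin n)) ⟩
    -P c1 m ∎
    where open ≡.≡-Reasoning

  c1-zero : c1 (V.replicate n 0ℤ) ≃ []
  c1-zero = ≃-trans (∑-map-cong (allFin n) monoP-lookup-0) (∑-map-0# (allFin n))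
    where
    monoP-lookup-0 : ∀ j → monoP (V.lookup (V.replicate n 0ℤ) j) j ≃ []
    monoP-lookup-0 j = ≃-trans (≡⇒≃ (cong (λ c → monoP c j) (lookup-replicate j 0ℤ))) (monoP-0ℤ j)

  cChar-negᵥ-0 : cChar (negᵥ (V.replicate n 0ℤ)) ≃ constP 1ℤ
  cChar-negᵥ-0 = begin
    constP 1ℤ +P c1 (negᵥ (V.replicate n 0ℤ))  ≡⟨ cong (constP 1ℤ +P_) (c1-negᵥ (V.replicate n 0ℤ)) ⟩
    constP 1ℤ +P -P c1 (V.replicate n 0ℤ)      ≈⟨ +-cong ≃-refl (-‿cong c1-zero) ⟩
    constP 1ℤ +P []                            ≡⟨⟩
    constP 1ℤ                                  ∎
    where open import Relation.Binary.Reasoning.Setoid ≃-setoid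

  cT-pos-dual-Q-D : ∀ bw (w : SVec n) → cT (pos (dualV (Q-D bw))) w ≃ constP 1ℤ
  cT-pos-dual-Q-D bw w = cT-trivial (suc (2 ℕ.* n))
    where
    cT-trivial : ∀ k → ∏ (L.map cChar (L.map negᵥ (L.replicate k (V.replicate n 0ℤ) ++ []))) ≃ constP 1ℤ
    cT-trivial zero    = ≃-refl
    cT-trivial (suc k) = ≃-trans (*-cong cChar-negᵥ-0 (cT-trivial k)) (*-identityˡ (constP 1ℤ))

  c1-sunitZ² : ∀ i b → c1 (sunitZ (i , b)) *P c1 (sunitZ (i , b)) ≃ t i *P t i
  c1-sunitZ² i true  = ≃-refl
  c1-sunitZ² i false = ≃-trans (≡⇒≃ (cong₂ _*P_ (c1-negᵥ (unitZ i)) (c1-negᵥ (unitZ i)))) (-x*-x≈x*x (t i))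

  cChar-sunitZ-pair : ∀ i b → cChar (sunitZ (i , b)) *P cChar (negᵥ (sunitZ (i , b))) ≃ constP 1ℤ -P t i *P t i
  cChar-sunitZ-pair i b = begin
    cChar x *P (constP 1ℤ +P c1 (negᵥ x))   ≡⟨ cong (λ p → cChar x *P (constP 1ℤ +P p)) (c1-negᵥ x) ⟩
    cChar x *P (constP 1ℤ -P c1 x)          ≈⟨ [1+x][1-x]≈1-x² (c1 x) ⟩
    constP 1ℤ -P c1 x *P c1 x               ≈⟨ +-cong ≃-refl (-‿cong (c1-sunitZ² i b)) ⟩
    constP 1ℤ -P t i *P t i                 ∎
    where
    x = sunitZ (i , b)
    open import Relation.Binary.Reasoning.Setoid ≃-setoid

  cT-I-D-dual : ∀ bw (w : SVec n) → cT (pos (I-D bw)) w *P cT (pos (dualV (I-D bw))) w ≃ ∏[1-t²]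
  cT-I-D-dual bw w = begin
    ∏ (L.map cChar (L.map σ is)) *P ∏ (L.map cChar (L.map negᵥ (L.map σ is)))
      ≡⟨ cong₂ (λ xs ys → ∏ xs *P ∏ ys) (sym (LP.map-∘ is))
               (trans (cong (L.map cChar) (sym (LP.map-∘ is))) (sym (LP.map-∘ is))) ⟩
    ∏ (L.map (λ i → cChar (σ i)) is) *P ∏ (L.map (λ i → cChar (negᵥ (σ i))) is)
      ≈⟨ ∏-map-distrib-* is _ _ ⟩
    ∏ (L.map (λ i → cChar (σ i) *P cChar (negᵥ (σ i))) is)
      ≈⟨ ∏-map-cong is (λ i → cChar-sunitZ-pair i (V.lookup (bw w) i)) ⟩
    ∏[1-t²] ∎
    where
    is = allFin n
    σ = λ i → sunitZ (i , V.lookup (bw w) i)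
    open import Relation.Binary.Reasoning.Setoid ≃-setoid

  ∏[1-t²]-1-InIdeal : InIdeal (∏[1-t²] -P constP 1ℤ)
  ∏[1-t²]-1-InIdeal = ∏[1+x]-1-InIdeal (allFin n) (λ i → -P (t i *P t i)) -t²-InIdeal
    where
    -t²-InIdeal : ∀ i → InIdeal (-P (t i *P t i))
    -t²-InIdeal i = InIdeal-resp-≈ (≃-sym (-‿distribʳ-* (t i) (t i))) (*ʳ-InIdeal (-P t i) (c1-InIdeal (unitZ i)))

  const-isPiecewisePoly : ∀ (p : Poly n) → IsPiecewisePoly {n} (λ _ → p)
  const-isPiecewisePoly p w _ =
    (λ i j _ → ℓ∣p-p (xt (V.lookup w i) -P xt (V.lookup w j))) , (λ i _ → ℓ∣p-p (xt (V.lookup w i)))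
    where
    ℓ∣p-p : ∀ ℓ → Divides ℓ (p -P p)
    ℓ∣p-p ℓ = [] , coeff-≡ (≃-trans (IsAbelianGroup.inverseʳ +-isAbelianGroup p) (≡⇒≃ (sym (*-zeroʳ ℓ))))

  ≋-of-constant-difference : ∀ (X Y : ChernFrac n) {k} → InIdeal k →
    (∀ w → IsSignedPerm w → num X w *P den Y w -P num Y w *P den X w ≃ k) → X ≋ Y
  ≋-of-constant-difference (_ // _) (_ // _) (h , k≃) x-y≃k =
    (λ j _ → h j) , (λ j → const-isPiecewisePoly (h j)) , λ w w∈W → coeff-≡ (≃-trans (x-y≃k w w∈W) k≃)

proposition3p7 : (n : ℕ) (D : DeltaMatroid n) (bw : SVec n → Feas n) → IsBw D bw →
    (chern (I-D bw) ≋ chern (dualV (Q-D bw)))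
    × (chern (I-D bw) ·c chern (dualV (I-D bw)) ≋ oneC)
proposition3p7 n D bw _ =
    ≋-of-constant-difference (chern (I-D bw)) (chern (dualV (Q-D bw))) ∏[1-t²]-1-InIdeal
      (λ w _ → +-cong (cT-I-D-dual bw w) (-‿cong (≃-trans (*-identityʳ _) (cT-pos-dual-Q-D bw w))))
  , ≋-of-constant-difference (chern (I-D bw) ·c chern (dualV (I-D bw))) oneC ∏[1-t²]-1-InIdeal
      (λ w _ → +-cong (≃-trans (*-identityʳ _) (cT-I-D-dual bw w)) (-‿cong (≃-trans (*-identityˡ _) (*-identityˡ _))))
  where open ChernClasses n
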